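{- Let $(A,+)$ be an abelian group and $\alpha,\beta\in A$. For every $n\ge 0$ and every $N\in\mathcal{M}(n)$, the first term of the sequence $seq_{\alpha,\beta}(N)$ equals $cr(N)\alpha+ne(N)\beta$.
   Context: A matching on $[2m]$ is a partition of $[2m]$ into two-element blocks (edges); $\mathcal{M}(m)$ is the set of such matchings, $\mathcal{M}(0)=\{\emptyset\}$. Edges $A,B$ cross if $\min A<\min B<\max A<\max B$ or vice versa, and are nested if $\min A<\min B<\max B<\max A$ or vice versa; $cr,ne$ count crossing and nested pairs. $M\in\mathcal{M}(m)$ has $2m+1$ gaps: gap 1 before point 1, gap $j$ between $j-1$ and $j$ ($2\le j\le 2m$), gap $2m+1$ after $2m$. Inserting a new first edge into gap $i$ gives the matching in $\mathcal{M}(m+1)$ obtained by relabeling the vertices of $M$ order-preservingly by $\{2,\dots,2m+2\}\setminus\{i+1\}$ and adding $\{1,i+1\}$; every matching in $\mathcal{M}(m+1)$ arises uniquely this way. For $x_1\dots x_l\in A^l$ and $y\in A$, $x_1\dots x_l+y=(x_1+y)\dots(x_l+y)$; for $1\le i\le l$, $R_{\alpha,\beta,i}(x_1\dots x_l)=x_i\,(x_1\dots x_i+x_i-x_1+\alpha)\,(x_i\dots x_l+x_i-x_1+\beta)$ (concatenation). $seq_{\alpha,\beta}(\emptyset)=(0_A)$, and if $N$ arises from $M$ by inserting a new first edge into gap $i$ of $M$, then $seq_{\alpha,\beta}(N)=R_{\alpha,\beta,i}(seq_{\alpha,\beta}(M))$. -}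

module Defs where

open import Level using (Level)
open import Data.Nat using (ℕ; zero; suc; _∸_; _<_; _<ᵇ_; _≡ᵇ_)
open import Data.Bool using (Bool; true; false; if_then_else_; _∧_; _∨_)
open import Data.Product using (_×_; _,_)
open import Data.Maybe using (Maybe; just; nothing)
open import Data.List using (List; []; _∷_; _++_; map; take; drop; length; concatMap; upTo)
open import Data.List.NonEmpty using (List⁺; _∷_; head; toList)
open import Data.List.Relation.Unary.All using (All)
open import Data.List.Relation.Binary.Permutation.Propositional using (_↭_)
open import Algebra.Bundles using (AbelianGroup)

-- Matchings.  A matching is a list of edges (a , b) with a < b; vertices
-- are the natural numbers 1 .. 2m.

Edge : Set
Edge = ℕ × ℕ

Matching : Set
Matching = List Edge

vertices : Matching → List ℕ
vertices = concatMap (λ { (a , b) → a ∷ b ∷ [] })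

range1 : ℕ → List ℕ
range1 k = map suc (upTo k)

-- N ∈ 𝓜(m): every edge is (a , b) with a < b, and the vertices of the
-- edges are exactly 1 .. 2m, each occurring once (a partition of [2m]
-- into two-element blocks).
IsMatching : ℕ → Matching → Set
IsMatching m N = All (λ { (a , b) → a < b }) N × (vertices N ↭ range1 (2 Data.Nat.* m))

_<<_ : ℕ → ℕ → Bool
_<<_ = _<ᵇ_

crosses : Edge → Edge → Bool
crosses (a , b) (c , d) =
  ((a << c) ∧ (c << b) ∧ (b << d)) ∨ ((c << a) ∧ (a << d) ∧ (d << b))

nests : Edge → Edge → Bool
nests (a , b) (c , d) =
  ((a << c) ∧ (c << d) ∧ (d << b)) ∨ ((c << a) ∧ (a << b) ∧ (b << d))

count : (Edge → Bool) → List Edge → ℕ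
count p [] = 0
count p (e ∷ es) = if p e then suc (count p es) else count p es

cr : Matching → ℕ
cr [] = 0
cr (e ∷ es) = count (crosses e) es Data.Nat.+ cr es

ne : Matching → ℕ
ne [] = 0
ne (e ∷ es) = count (nests e) es Data.Nat.+ ne es

-- Inverse of "inserting a new first edge": for N ∈ 𝓜(m+1), find the edge
-- {1, j} (so N arises from M by inserting into gap i = j - 1) and compute
-- M by removing that edge and relabelling order-preservingly
-- {2,…,2m+2} ∖ {j} → {1,…,2m}.

extract : Matching → Maybe (ℕ × Matching)
extract [] = nothing
extract ((a , b) ∷ es) with a ≡ᵇ 1
... | true = just (b , es)
... | false with extract es
...   | nothing = nothing
...   | just (j , rest) = just (j , (a , b) ∷ rest)

relabelV : ℕ → ℕ → ℕ
relabelV j v = if v <ᵇ j then v ∸ 1 else v ∸ 2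

relabel : ℕ → Matching → Matching
relabel j = map (λ { (a , b) → relabelV j a , relabelV j b })

-- Sequences over an abelian group (written additively: _∙_ is +).

module _ {c ℓ : Level} (G : AbelianGroup c ℓ) where
  open AbelianGroup G

  times : ℕ → Carrier → Carrier
  times zero x = ε
  times (suc k) x = x ∙ times k x

  shift : List Carrier → Carrier → List Carrier
  shift xs y = map (λ x → x ∙ y) xs

  -- x_k (1-based), with a default for out-of-range indices (never used
  -- for 1 ≤ k ≤ l)
  nth : Carrier → ℕ → List Carrier → Carrier
  nth d k [] = d
  nth d zero (x ∷ xs) = d
  nth d (suc zero) (x ∷ xs) = x
  nth d (suc (suc k)) (x ∷ xs) = nth d (suc k) xs

  -- R_{α,β,i}(x₁…x_l) = x_i (x₁…x_i + x_i − x₁ + α) (x_i…x_l + x_i − x₁ + β)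
  R : Carrier → Carrier → ℕ → List⁺ Carrier → List⁺ Carrier
  R α β i xs =
    let l  = toList xs
        x₁ = head xs
        xᵢ = nth x₁ i l
        c  = xᵢ ∙ (x₁ ⁻¹)
    in xᵢ ∷ (shift (take i l) (c ∙ α) ++ shift (drop (i ∸ 1) l) (c ∙ β))

  -- seq with fuel (the number of edges)
  seqF : Carrier → Carrier → ℕ → Matching → List⁺ Carrier
  seqF α β zero N = ε ∷ []
  seqF α β (suc k) N with extract N
  ... | nothing = ε ∷ []
  ... | just (j , rest) = R α β (j ∸ 1) (seqF α β k (relabel j rest))

  seq : Carrier → Carrier → Matching → List⁺ Carrier
  seq α β N = seqF α β (length N) N

-- Write c_k(X) for the number of edges of a matching X that span gap k and d_k(X) for the
-- number of edges lying left of gap k.  By induction on the number of edges, the k-th term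
-- of seq_{α,β}(X) is (cr X + c_k(X)) α + (ne X + d_k(X)) β, and at gap 1 both counts vanish.
-- If N arises from M by inserting the edge {1, i+1} into gap i, the new edge crosses exactly
-- the c_i(M) edges spanning gap i and nests the d_i(M) edges left of it, so for the terms x
-- of seq(M) the difference x_i - x_1 is (cr N - cr M) α + (ne N - ne M) β.  The gaps 2 … i+1
-- of N lie under the new edge and gain one spanning edge, the later gaps gain one edge to
-- their left: these are the extra α and β added by R_{α,β,i}.

module Submission where

open import Defs
open import Level using (Level)
open import Data.Bool using (Bool; true; false; not; _∧_)
open import Data.Bool.Properties using (∨-comm; ∨-identityʳ; T-≡)
open import Function.Bundles using (module Equivalence)
open import Data.Nat using (ℕ; zero; suc; _+_; _*_; _∸_; _<_; _≤_; _<ᵇ_; _≡ᵇ_; z≤n; s≤s)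
open import Data.Nat.Properties
  using ( +-comm; +-suc; +-identityʳ; *-suc; *-cancelˡ-≡; suc-injective; ≤-refl; ≤-pred; <⇒≤; m<m+n
        ; m+[n∸m]≡n; m≤n⇒m≤1+n; <ᵇ⇒<; <⇒<ᵇ; ≡ᵇ⇒≡; ≡⇒≡ᵇ)
open import Data.Nat.ListAction using (sum)
open import Data.Nat.ListAction.Properties using (sum-↭)
open import Data.Nat.Tactic.RingSolver using (solve-∀)
open import Data.Product using (_×_; _,_; proj₁; proj₂)
open import Data.Maybe using (just; nothing)
open import Data.Empty using (⊥-elim)
open import Relation.Nullary using (¬_)
open import Data.List using (List; []; _∷_; _++_; map; take; drop; length; upTo)
open import Data.List.Properties using (length-map; map-++; map-upTo; length-upTo; take-map; drop-map)
open import Data.List.NonEmpty using (_∷_; head; toList)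
import Data.List.Relation.Unary.All as All
open All using (All; []; _∷_)
open import Data.List.Relation.Binary.Pointwise using (Pointwise; []; _∷_; ++⁺)
open import Data.List.Relation.Binary.Permutation.Propositional using (_↭_; refl; prep; swap; trans)
open import Data.List.Relation.Binary.Permutation.Propositional.Properties
  using (map⁺; All-resp-↭; ↭-length)
open import Algebra.Bundles using (AbelianGroup)
open import Relation.Binary.PropositionalEquality as ≡ using (_≡_; refl; cong; cong₂)

fromBool : Bool → ℕ
fromBool true = 1
fromBool false = 0

fromBool+≡0 : ∀ x n → fromBool x + n ≡ 0 → (x ≡ false) × (n ≡ 0)
fromBool+≡0 false n eq = refl , eq

suc≡fromBool : ∀ b n → suc n ≡ fromBool b → (b ≡ true) × (n ≡ 0)
suc≡fromBool true zero _ = refl , refl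

≤⇒≮ᵇ : ∀ i p → p ≤ i → (i <ᵇ p) ≡ false
≤⇒≮ᵇ i zero _ = refl
≤⇒≮ᵇ (suc i) (suc p) (s≤s p≤i) = ≤⇒≮ᵇ i p p≤i

≤⇒<ᵇsuc : ∀ i p → i ≤ p → (i <ᵇ suc p) ≡ true
≤⇒<ᵇsuc i p i≤p = Equivalence.to T-≡ (<⇒<ᵇ (s≤s i≤p))

<ᵇ-false∧≡ᵇ-false⇒> : ∀ k w → (w <ᵇ k) ≡ false → (w ≡ᵇ k) ≡ false → k < w
<ᵇ-false∧≡ᵇ-false⇒> zero zero _ ()
<ᵇ-false∧≡ᵇ-false⇒> zero (suc w) _ _ = s≤s z≤n
<ᵇ-false∧≡ᵇ-false⇒> (suc k) zero () _
<ᵇ-false∧≡ᵇ-false⇒> (suc k) (suc w) w≮k w≢k = s≤s (<ᵇ-false∧≡ᵇ-false⇒> k w w≮k w≢k)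

rearrange-suc : ∀ a p q → (a + p) + (q + 1) ≡ (q + a) + suc p
rearrange-suc = solve-∀

rearrange : ∀ a p q → (a + p) + (q + 0) ≡ (q + a) + p
rearrange = solve-∀

count-∷ : ∀ p e es → count p (e ∷ es) ≡ fromBool (p e) + count p es
count-∷ p e es with p e
... | true = refl
... | false = refl

count≡sum : ∀ p es → count p es ≡ sum (map (λ e → fromBool (p e)) es)
count≡sum p [] = refl
count≡sum p (e ∷ es) = ≡.trans (count-∷ p e es) (cong (fromBool (p e) +_) (count≡sum p es))

count-↭ : ∀ p {es es′} → es ↭ es′ → count p es ≡ count p es′
count-↭ p {es} {es′} σ =
  ≡.trans (count≡sum p es) (≡.trans (sum-↭ (map⁺ _ σ)) (≡.sym (count≡sum p es′)))

count-map : ∀ p (f : Edge → Edge) es → count p (map f es) ≡ count (λ e → p (f e)) es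
count-map p f [] = refl
count-map p f (e ∷ es) with p (f e)
... | true = cong suc (count-map p f es)
... | false = count-map p f es

count-cong : ∀ {p q} {es} → All (λ e → p e ≡ q e) es → count p es ≡ count q es
count-cong [] = refl
count-cong {p} {q} {e ∷ es} (pe≡qe ∷ rest) = begin
  count p (e ∷ es)             ≡⟨ count-∷ p e es ⟩
  fromBool (p e) + count p es  ≡⟨ cong₂ _+_ (cong fromBool pe≡qe) (count-cong rest) ⟩
  fromBool (q e) + count q es  ≡⟨ ≡.sym (count-∷ q e es) ⟩
  count q (e ∷ es)             ∎
  where open ≡.≡-Reasoning

pairCount : (Edge → Edge → Bool) → Matching → ℕ
pairCount q [] = 0
pairCount q (e ∷ es) = count (q e) es + pairCount q es

pairCount-↭ : ∀ q → (∀ e e′ → q e e′ ≡ q e′ e) →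
              ∀ {es es′} → es ↭ es′ → pairCount q es ≡ pairCount q es′
pairCount-↭ q q-sym refl = refl
pairCount-↭ q q-sym (prep e σ) = cong₂ _+_ (count-↭ (q e) σ) (pairCount-↭ q q-sym σ)
pairCount-↭ q q-sym (swap {xs} {ys} e e′ σ)
  rewrite count-∷ (q e) e′ xs | count-∷ (q e′) e ys | q-sym e′ e
        | count-↭ (q e) σ | count-↭ (q e′) σ | pairCount-↭ q q-sym σ
  = swap-middle (fromBool (q e e′)) (count (q e) ys) (count (q e′) ys) (pairCount q ys)
  where
  swap-middle : ∀ a b c d → (a + b) + (c + d) ≡ (a + c) + (b + d)
  swap-middle = solve-∀
pairCount-↭ q q-sym (trans σ τ) = ≡.trans (pairCount-↭ q q-sym σ) (pairCount-↭ q q-sym τ)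

pairCount-map : ∀ q q′ (f : Edge → Edge) → (∀ e e′ → q (f e) (f e′) ≡ q′ e e′) →
                ∀ es → pairCount q (map f es) ≡ pairCount q′ es
pairCount-map q q′ f f-resp [] = refl
pairCount-map q q′ f f-resp (e ∷ es) =
  cong₂ _+_ (≡.trans (count-map (q (f e)) f es) (count-cong (All.universal (f-resp e) es)))
            (pairCount-map q q′ f f-resp es)

cr≡pairCount : ∀ N → cr N ≡ pairCount crosses N
cr≡pairCount [] = refl
cr≡pairCount (e ∷ es) = cong (count (crosses e) es +_) (cr≡pairCount es)

ne≡pairCount : ∀ N → ne N ≡ pairCount nests N
ne≡pairCount [] = refl
ne≡pairCount (e ∷ es) = cong (count (nests e) es +_) (ne≡pairCount es)

crosses-sym : ∀ e e′ → crosses e e′ ≡ crosses e′ e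
crosses-sym (a , b) (c , d) = ∨-comm ((a << c) ∧ (c << b) ∧ (b << d)) ((c << a) ∧ (a << d) ∧ (d << b))

nests-sym : ∀ e e′ → nests e e′ ≡ nests e′ e
nests-sym (a , b) (c , d) = ∨-comm ((a << c) ∧ (c << d) ∧ (d << b)) ((c << a) ∧ (a << b) ∧ (b << d))

occurrences : ℕ → List ℕ → ℕ
occurrences v xs = sum (map (λ x → fromBool (x ≡ᵇ v)) xs)

occurrences-↭ : ∀ v {xs ys} → xs ↭ ys → occurrences v xs ≡ occurrences v ys
occurrences-↭ v σ = sum-↭ (map⁺ _ σ)

vertices-↭ : ∀ {N N′} → N ↭ N′ → vertices N ↭ vertices N′
vertices-↭ refl = refl
vertices-↭ (prep (a , b) σ) = prep a (prep b (vertices-↭ σ))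
vertices-↭ (swap (a , b) (c , d) σ) =
  trans (prep a (prep b (prep c (prep d (vertices-↭ σ)))))
  (trans (prep a (swap b c refl))
  (trans (swap a c refl)
  (trans (prep c (prep a (swap b d refl)))
         (prep c (swap a d refl)))))
vertices-↭ (trans σ τ) = trans (vertices-↭ σ) (vertices-↭ τ)

inRange1 : ℕ → ℕ → ℕ
inRange1 K zero = 0
inRange1 K (suc v) = fromBool (v <ᵇ K)

occurrences-zero-map-suc : ∀ xs → occurrences 0 (map suc xs) ≡ 0
occurrences-zero-map-suc [] = refl
occurrences-zero-map-suc (x ∷ xs) = occurrences-zero-map-suc xs

occurrences-suc-map-suc : ∀ v xs → occurrences (suc v) (map suc xs) ≡ occurrences v xs
occurrences-suc-map-suc v [] = refl
occurrences-suc-map-suc v (x ∷ xs) = cong (fromBool (x ≡ᵇ v) +_) (occurrences-suc-map-suc v xs)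

occurrences-upTo : ∀ v k → occurrences v (upTo k) ≡ fromBool (v <ᵇ k)
occurrences-upTo v zero = refl
occurrences-upTo zero (suc k)
  rewrite ≡.sym (map-upTo suc k) = cong suc (occurrences-zero-map-suc (upTo k))
occurrences-upTo (suc v) (suc k)
  rewrite ≡.sym (map-upTo suc k) = ≡.trans (occurrences-suc-map-suc v (upTo k)) (occurrences-upTo v k)

occurrences-range1 : ∀ v K → occurrences v (range1 K) ≡ inRange1 K v
occurrences-range1 zero K = occurrences-zero-map-suc (upTo K)
occurrences-range1 (suc v) K = ≡.trans (occurrences-suc-map-suc v (upTo K)) (occurrences-upTo v K)

inRange1-0 : ∀ v → inRange1 0 v ≡ 0
inRange1-0 zero = refl
inRange1-0 (suc v) = refl

PositiveEdge : Edge → Set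
PositiveEdge (a , b) = (1 ≤ a) × (a < b)

OrderedEdge : Edge → Set
OrderedEdge (a , b) = a < b

record IsMatching′ (m : ℕ) (N : Matching) : Set where
  field
    ordered      : All OrderedEdge N
    multiplicity : ∀ v → occurrences v (vertices N) ≡ inRange1 (2 * m) v

open IsMatching′

IsMatching⇒IsMatching′ : ∀ {n N} → IsMatching n N → IsMatching′ n N
IsMatching⇒IsMatching′ {n} (ordered , σ) = record
  { ordered      = All.map (λ { {_ , _} a<b → a<b }) ordered
  ; multiplicity = λ v → ≡.trans (occurrences-↭ v σ) (occurrences-range1 v (2 * n))
  }

length-vertices : ∀ N → length (vertices N) ≡ 2 * length N
length-vertices [] = refl
length-vertices (e ∷ es) =
  ≡.trans (cong (λ l → suc (suc l)) (length-vertices es)) (≡.sym (*-suc 2 (length es)))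

IsMatching-length : ∀ {n N} → IsMatching n N → length N ≡ n
IsMatching-length {n} {N} (_ , σ) = *-cancelˡ-≡ (length N) n 2 (begin
  2 * length N            ≡⟨ length-vertices N ⟨
  length (vertices N)     ≡⟨ ↭-length σ ⟩
  length (range1 (2 * n)) ≡⟨ length-map suc (upTo (2 * n)) ⟩
  length (upTo (2 * n))   ≡⟨ length-upTo (2 * n) ⟩
  2 * n                   ∎)
  where open ≡.≡-Reasoning

positive : ∀ N → All OrderedEdge N → occurrences 0 (vertices N) ≡ 0 → All PositiveEdge N
positive [] [] _ = []
positive ((zero , b) ∷ es) _ ()
positive ((suc a , b) ∷ es) (a<b ∷ ord) no0 =
  (s≤s z≤n , a<b) ∷ positive es ord (proj₂ (fromBool+≡0 (b ≡ᵇ 0) _ no0))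

IsMatching′-positive : ∀ {m N} → IsMatching′ m N → All PositiveEdge N
IsMatching′-positive {N = N} N-matching = positive N (ordered N-matching) (multiplicity N-matching 0)

IsMatching′-0-empty : ∀ {e es} → ¬ IsMatching′ 0 (e ∷ es)
IsMatching′-0-empty {a , b} N-matching
  with a-absent ← fromBool+≡0 (a ≡ᵇ a) _ (≡.trans (multiplicity N-matching a) (inRange1-0 a))
  with () ← ≡.trans (≡.sym (Equivalence.to T-≡ (≡⇒≡ᵇ a a refl))) (proj₁ a-absent)

-- On the vertices 1 .. 2m of a matching, insertV i is the order-preserving relabelling
-- by {2, …, 2m+2} ∖ {i+1} that makes room for a new first edge (1 , i+1) in gap i.
insertV : ℕ → ℕ → ℕ
insertV zero v = suc (suc v)
insertV (suc i) zero = 1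
insertV (suc i) (suc v) = suc (insertV i v)

insertE : ℕ → Edge → Edge
insertE i (a , b) = insertV i a , insertV i b

insertV-positive : ∀ i v → (0 <ᵇ insertV i v) ≡ true
insertV-positive zero v = refl
insertV-positive (suc i) zero = refl
insertV-positive (suc i) (suc v) = refl

insertV-≢0 : ∀ i v → (0 ≡ᵇ insertV i v) ≡ false
insertV-≢0 zero v = refl
insertV-≢0 (suc i) zero = refl
insertV-≢0 (suc i) (suc v) = refl

insertV-≢new : ∀ i v → (suc i ≡ᵇ insertV i v) ≡ false
insertV-≢new zero v = refl
insertV-≢new (suc i) zero = refl
insertV-≢new (suc i) (suc v) = insertV-≢new i v

insertV-<ᵇ : ∀ i v w → (insertV i v <ᵇ insertV i w) ≡ (v <ᵇ w)
insertV-<ᵇ zero v w = refl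
insertV-<ᵇ (suc i) zero zero = refl
insertV-<ᵇ (suc i) zero (suc w) = insertV-positive i w
insertV-<ᵇ (suc i) (suc v) zero = refl
insertV-<ᵇ (suc i) (suc v) (suc w) = insertV-<ᵇ i v w

insertV-≡ᵇ : ∀ i v w → (insertV i v ≡ᵇ insertV i w) ≡ (v ≡ᵇ w)
insertV-≡ᵇ zero v w = refl
insertV-≡ᵇ (suc i) zero zero = refl
insertV-≡ᵇ (suc i) zero (suc w) = insertV-≢0 i w
insertV-≡ᵇ (suc i) (suc v) zero with insertV i v | insertV-positive i v
... | suc _ | _ = refl
insertV-≡ᵇ (suc i) (suc v) (suc w) = insertV-≡ᵇ i v w

insertV-<ᵇ-below : ∀ i p v → p ≤ i → (insertV i v <ᵇ suc p) ≡ (v <ᵇ p)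
insertV-<ᵇ-below zero zero v z≤n = refl
insertV-<ᵇ-below (suc i) zero zero z≤n = refl
insertV-<ᵇ-below (suc i) zero (suc v) z≤n = refl
insertV-<ᵇ-below (suc i) (suc p) zero (s≤s p≤i) = refl
insertV-<ᵇ-below (suc i) (suc p) (suc v) (s≤s p≤i) = insertV-<ᵇ-below i p v p≤i

insertV-<ᵇ-above : ∀ i p v → i ≤ p → (insertV i v <ᵇ suc (suc p)) ≡ (v <ᵇ p)
insertV-<ᵇ-above zero p v z≤n = refl
insertV-<ᵇ-above (suc i) (suc p) zero (s≤s i≤p) = refl
insertV-<ᵇ-above (suc i) (suc p) (suc v) (s≤s i≤p) = insertV-<ᵇ-above i p v i≤p

new<ᵇinsertV : ∀ i v → (suc i <ᵇ insertV i v) ≡ not (v <ᵇ i)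
new<ᵇinsertV zero v = refl
new<ᵇinsertV (suc i) zero = refl
new<ᵇinsertV (suc i) (suc v) = new<ᵇinsertV i v

insertV-< : ∀ i v → v < i → insertV i v ≡ suc v
insertV-< (suc i) zero v<i = refl
insertV-< (suc i) (suc v) (s≤s v<i) = cong suc (insertV-< i v v<i)

insertV-≥ : ∀ i v → i ≤ v → insertV i v ≡ suc (suc v)
insertV-≥ zero v i≤v = refl
insertV-≥ (suc i) (suc v) (s≤s i≤v) = cong suc (insertV-≥ i v i≤v)

insertV-relabelV : ∀ k v → (v ≡ᵇ 0) ≡ false → (v ≡ᵇ 1) ≡ false → (v ≡ᵇ suc (suc k)) ≡ false →
                   insertV (suc k) (relabelV (suc (suc k)) v) ≡ v
insertV-relabelV k zero () _ _
insertV-relabelV k (suc zero) _ () _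
insertV-relabelV k (suc (suc w)) _ _ w≢k with w <ᵇ k in w<ᵇk
... | true = cong suc (insertV-< k w (<ᵇ⇒< w k (Equivalence.from T-≡ w<ᵇk)))
... | false = insertV-≥ (suc k) w (<ᵇ-false∧≡ᵇ-false⇒> k w w<ᵇk w≢k)

1<ᵇinsertV-suc : ∀ i v → (1 <ᵇ insertV i (suc v)) ≡ true
1<ᵇinsertV-suc zero v = refl
1<ᵇinsertV-suc (suc i) v = insertV-positive i v

insertE-relabel : ∀ k rest →
  occurrences 0 (vertices rest) ≡ 0 → occurrences 1 (vertices rest) ≡ 0 →
  occurrences (suc (suc k)) (vertices rest) ≡ 0 →
  map (insertE (suc k)) (relabel (suc (suc k)) rest) ≡ rest
insertE-relabel k [] _ _ _ = refl
insertE-relabel k ((a , b) ∷ es) no0 no1 noj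
  with fromBool+≡0 (a ≡ᵇ 0) _ no0 | fromBool+≡0 (a ≡ᵇ 1) _ no1 | fromBool+≡0 (a ≡ᵇ suc (suc k)) _ noj
... | a≢0 , no0′ | a≢1 , no1′ | a≢j , noj′
  with fromBool+≡0 (b ≡ᵇ 0) _ no0′ | fromBool+≡0 (b ≡ᵇ 1) _ no1′ | fromBool+≡0 (b ≡ᵇ suc (suc k)) _ noj′
... | b≢0 , no0″ | b≢1 , no1″ | b≢j , noj″ =
  cong₂ _∷_ (cong₂ _,_ (insertV-relabelV k a a≢0 a≢1 a≢j) (insertV-relabelV k b b≢0 b≢1 b≢j))
            (insertE-relabel k es no0″ no1″ noj″)

occurrences-map-insertV : ∀ i u xs → occurrences (insertV i u) (map (insertV i) xs) ≡ occurrences u xs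
occurrences-map-insertV i u [] = refl
occurrences-map-insertV i u (x ∷ xs) =
  cong₂ _+_ (cong fromBool (insertV-≡ᵇ i x u)) (occurrences-map-insertV i u xs)

vertices-map-insertE : ∀ i M → vertices (map (insertE i) M) ≡ map (insertV i) (vertices M)
vertices-map-insertE i [] = refl
vertices-map-insertE i ((a , b) ∷ es) =
  cong (λ vs → insertV i a ∷ insertV i b ∷ vs) (vertices-map-insertE i es)

insertE-reflects-order : ∀ i M → All OrderedEdge (map (insertE i) M) → All OrderedEdge M
insertE-reflects-order i [] [] = []
insertE-reflects-order i ((a , b) ∷ es) (a<b ∷ ord) =
  <ᵇ⇒< a b (Equivalence.from T-≡ (≡.trans (≡.sym (insertV-<ᵇ i a b)) (Equivalence.to T-≡ (<⇒<ᵇ a<b))))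
  ∷ insertE-reflects-order i es ord

-- Gap k lies between the vertices k - 1 and k.
spansGap : ℕ → Edge → Bool
spansGap k (a , b) = (a <ᵇ k) ∧ not (b <ᵇ k)

leftOfGap : ℕ → Edge → Bool
leftOfGap k (a , b) = b <ᵇ k

spanning : Matching → ℕ → ℕ
spanning X k = count (spansGap k) X

leftOf : Matching → ℕ → ℕ
leftOf X k = count (leftOfGap k) X

spanning-gap1 : ∀ X → All PositiveEdge X → spanning X 1 ≡ 0
spanning-gap1 [] [] = refl
spanning-gap1 ((suc a , b) ∷ es) (_ ∷ pos) = spanning-gap1 es pos

leftOf-gap1 : ∀ X → All PositiveEdge X → leftOf X 1 ≡ 0
leftOf-gap1 [] [] = refl
leftOf-gap1 ((suc a , suc b) ∷ es) (_ ∷ pos) = leftOf-gap1 es pos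

crosses-new-insertE : ∀ i e → PositiveEdge e → crosses (1 , suc i) (insertE i e) ≡ spansGap i e
crosses-new-insertE i (suc a , b) _
  rewrite insertV-<ᵇ-below i 0 (suc a) z≤n | insertV-<ᵇ-below i i (suc a) ≤-refl | new<ᵇinsertV i b
        | 1<ᵇinsertV-suc i a
  = ∨-identityʳ _

nests-new-insertE : ∀ i e → PositiveEdge e → nests (1 , suc i) (insertE i e) ≡ leftOfGap i e
nests-new-insertE i (suc a , b) (_ , a<b)
  rewrite insertV-<ᵇ-below i 0 (suc a) z≤n | insertV-<ᵇ i (suc a) b | insertV-<ᵇ-below i i b ≤-refl
        | 1<ᵇinsertV-suc i a | Equivalence.to T-≡ (<⇒<ᵇ a<b)
  = ∨-identityʳ _

crosses-insertE : ∀ i e e′ → crosses (insertE i e) (insertE i e′) ≡ crosses e e′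
crosses-insertE i (a , b) (c , d)
  rewrite insertV-<ᵇ i a c | insertV-<ᵇ i c b | insertV-<ᵇ i b d
        | insertV-<ᵇ i c a | insertV-<ᵇ i a d | insertV-<ᵇ i d b
  = refl

nests-insertE : ∀ i e e′ → nests (insertE i e) (insertE i e′) ≡ nests e e′
nests-insertE i (a , b) (c , d)
  rewrite insertV-<ᵇ i a c | insertV-<ᵇ i c d | insertV-<ᵇ i d b
        | insertV-<ᵇ i c a | insertV-<ᵇ i a b | insertV-<ᵇ i b d
  = refl

spansGap-insertE-below : ∀ i p e → p ≤ i → spansGap (suc p) (insertE i e) ≡ spansGap p e
spansGap-insertE-below i p (a , b) p≤i
  rewrite insertV-<ᵇ-below i p a p≤i | insertV-<ᵇ-below i p b p≤i = refl

leftOfGap-insertE-below : ∀ i p e → p ≤ i → leftOfGap (suc p) (insertE i e) ≡ leftOfGap p e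
leftOfGap-insertE-below i p (a , b) = insertV-<ᵇ-below i p b

spansGap-insertE-above : ∀ i p e → i ≤ p → spansGap (suc (suc p)) (insertE i e) ≡ spansGap p e
spansGap-insertE-above i p (a , b) i≤p
  rewrite insertV-<ᵇ-above i p a i≤p | insertV-<ᵇ-above i p b i≤p = refl

leftOfGap-insertE-above : ∀ i p e → i ≤ p → leftOfGap (suc (suc p)) (insertE i e) ≡ leftOfGap p e
leftOfGap-insertE-above i p (a , b) = insertV-<ᵇ-above i p b

module Insertion (i : ℕ) (M N : Matching) (M-positive : All PositiveEdge M)
                 (σ : N ↭ (1 , suc i) ∷ map (insertE i) M) where

  count-inserted : ∀ p → count p N ≡ fromBool (p (1 , suc i)) + count (λ e → p (insertE i e)) M
  count-inserted p = begin
    count p N                          ≡⟨ count-↭ p σ ⟩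
    count p ((1 , suc i) ∷ map (insertE i) M)
      ≡⟨ count-∷ p (1 , suc i) (map (insertE i) M) ⟩
    fromBool (p (1 , suc i)) + count p (map (insertE i) M)
      ≡⟨ cong (fromBool (p (1 , suc i)) +_) (count-map p (insertE i) M) ⟩
    fromBool (p (1 , suc i)) + count (λ e → p (insertE i e)) M ∎
    where open ≡.≡-Reasoning

  pairCount-inserted : ∀ q → (∀ e e′ → q e e′ ≡ q e′ e) →
                       (∀ e e′ → q (insertE i e) (insertE i e′) ≡ q e e′) →
                       pairCount q N ≡ count (λ e → q (1 , suc i) (insertE i e)) M + pairCount q M
  pairCount-inserted q q-sym q-insertE = ≡.trans (pairCount-↭ q q-sym σ)
    (cong₂ _+_ (count-map (q (1 , suc i)) (insertE i) M) (pairCount-map q q (insertE i) q-insertE M))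

  cr-inserted : cr N ≡ spanning M i + cr M
  cr-inserted = begin
    cr N                  ≡⟨ cr≡pairCount N ⟩
    pairCount crosses N   ≡⟨ pairCount-inserted crosses crosses-sym (crosses-insertE i) ⟩
    count (λ e → crosses (1 , suc i) (insertE i e)) M + pairCount crosses M
      ≡⟨ cong₂ _+_ (count-cong (All.map (λ {e} → crosses-new-insertE i e) M-positive))
                   (≡.sym (cr≡pairCount M)) ⟩
    spanning M i + cr M   ∎
    where open ≡.≡-Reasoning

  ne-inserted : ne N ≡ leftOf M i + ne M
  ne-inserted = begin
    ne N                  ≡⟨ ne≡pairCount N ⟩
    pairCount nests N     ≡⟨ pairCount-inserted nests nests-sym (nests-insertE i) ⟩
    count (λ e → nests (1 , suc i) (insertE i e)) M + pairCount nests M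
      ≡⟨ cong₂ _+_ (count-cong (All.map (λ {e} → nests-new-insertE i e) M-positive))
                   (≡.sym (ne≡pairCount M)) ⟩
    leftOf M i + ne M     ∎
    where open ≡.≡-Reasoning

  spanning-inserted-inside : ∀ p → 1 ≤ p → p ≤ i → spanning N (suc p) ≡ suc (spanning M p)
  spanning-inserted-inside (suc p) _ p≤i = ≡.trans (count-inserted (spansGap (suc (suc p))))
    (cong₂ _+_ (cong (λ b → fromBool (not b)) (≤⇒≮ᵇ i (suc p) p≤i))
               (count-cong (All.universal (λ e → spansGap-insertE-below i (suc p) e p≤i) M)))

  leftOf-inserted-inside : ∀ p → p ≤ i → leftOf N (suc p) ≡ leftOf M p
  leftOf-inserted-inside p p≤i = ≡.trans (count-inserted (leftOfGap (suc p)))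
    (cong₂ _+_ (cong fromBool (≤⇒≮ᵇ i p p≤i))
               (count-cong (All.universal (λ e → leftOfGap-insertE-below i p e p≤i) M)))

  spanning-inserted-outside : ∀ p → i ≤ p → spanning N (suc (suc p)) ≡ spanning M p
  spanning-inserted-outside p i≤p = ≡.trans (count-inserted (spansGap (suc (suc p))))
    (cong₂ _+_ (cong (λ b → fromBool (not b)) (≤⇒<ᵇsuc i p i≤p))
               (count-cong (All.universal (λ e → spansGap-insertE-above i p e i≤p) M)))

  leftOf-inserted-outside : ∀ p → i ≤ p → leftOf N (suc (suc p)) ≡ suc (leftOf M p)
  leftOf-inserted-outside p i≤p = ≡.trans (count-inserted (leftOfGap (suc (suc p))))
    (cong₂ _+_ (cong fromBool (≤⇒<ᵇsuc i p i≤p))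
               (count-cong (All.universal (λ e → leftOfGap-insertE-above i p e i≤p) M)))

extract-↭ : ∀ N {j rest} → extract N ≡ just (j , rest) → N ↭ (1 , j) ∷ rest
extract-↭ [] ()
extract-↭ ((a , b) ∷ es) eq with a ≡ᵇ 1 in a≡1
extract-↭ ((a , b) ∷ es) refl | true
  rewrite ≡ᵇ⇒≡ a 1 (Equivalence.from T-≡ a≡1) = refl
extract-↭ ((a , b) ∷ es) eq | false with extract es in es-eq
extract-↭ ((a , b) ∷ es) refl | false | just (j , rest) =
  trans (prep (a , b) (extract-↭ es es-eq)) (swap (a , b) (1 , j) refl)

extract≡nothing⇒1∉ : ∀ N → All PositiveEdge N → extract N ≡ nothing →
                     occurrences 1 (vertices N) ≡ 0
extract≡nothing⇒1∉ [] _ _ = refl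
extract≡nothing⇒1∉ ((zero , b) ∷ es) ((() , _) ∷ _) _
extract≡nothing⇒1∉ ((suc zero , b) ∷ es) _ ()
extract≡nothing⇒1∉ ((suc (suc a) , suc zero) ∷ es) ((_ , s≤s ()) ∷ _) _
extract≡nothing⇒1∉ ((suc (suc a) , suc (suc b)) ∷ es) (_ ∷ pos) eq with extract es in es-eq
extract≡nothing⇒1∉ ((suc (suc a) , suc (suc b)) ∷ es) (_ ∷ pos) () | just _
extract≡nothing⇒1∉ ((suc (suc a) , suc (suc b)) ∷ es) (_ ∷ pos) eq | nothing =
  extract≡nothing⇒1∉ es pos es-eq

IsMatching′-extract≢nothing : ∀ {m N} → IsMatching′ (suc m) N → ¬ (extract N ≡ nothing)
IsMatching′-extract≢nothing {N = N} N-matching eq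
  with () ← ≡.trans (≡.sym (extract≡nothing⇒1∉ N (IsMatching′-positive N-matching) eq))
                    (multiplicity N-matching 1)

extract-first-edge-ordered : ∀ {m N j rest} → IsMatching′ m N → extract N ≡ just (j , rest) → 1 < j
extract-first-edge-ordered {N = N} N-matching eq
  with 1<j ∷ _ ← All-resp-↭ (extract-↭ N eq) (ordered N-matching) = 1<j

module Removal (m i : ℕ) (rest N : Matching) (N-matching : IsMatching′ (suc m) N)
               (σ : N ↭ (1 , suc (suc i)) ∷ rest) where

  occurrences-N : ∀ v → occurrences v (vertices N)
                      ≡ fromBool (1 ≡ᵇ v) + (fromBool (suc (suc i) ≡ᵇ v) + occurrences v (vertices rest))
  occurrences-N v = occurrences-↭ v (vertices-↭ σ)

  0∉rest : occurrences 0 (vertices rest) ≡ 0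
  0∉rest = ≡.trans (≡.sym (occurrences-N 0)) (multiplicity N-matching 0)

  1∉rest : occurrences 1 (vertices rest) ≡ 0
  1∉rest = suc-injective (≡.trans (≡.sym (occurrences-N 1)) (multiplicity N-matching 1))

  j-occurrence : suc (occurrences (suc (suc i)) (vertices rest)) ≡ fromBool (suc i <ᵇ 2 * suc m)
  j-occurrence = begin
    suc (occurrences (suc (suc i)) (vertices rest))
      ≡⟨ cong (λ b → fromBool b + occurrences (suc (suc i)) (vertices rest))
              (≡.sym (Equivalence.to T-≡ (≡⇒≡ᵇ i i refl))) ⟩
    fromBool (i ≡ᵇ i) + occurrences (suc (suc i)) (vertices rest)
      ≡⟨ ≡.sym (occurrences-N (suc (suc i))) ⟩
    occurrences (suc (suc i)) (vertices N)
      ≡⟨ multiplicity N-matching (suc (suc i)) ⟩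
    fromBool (suc i <ᵇ 2 * suc m) ∎
    where open ≡.≡-Reasoning

  j∉rest : occurrences (suc (suc i)) (vertices rest) ≡ 0
  j∉rest = proj₂ (suc≡fromBool _ _ j-occurrence)

  gap-bound : i ≤ 2 * m
  gap-bound = ≤-pred (≤-pred (≡.subst (suc i <_) (*-suc 2 m)
    (<ᵇ⇒< (suc i) (2 * suc m) (Equivalence.from T-≡ (proj₁ (suc≡fromBool _ _ j-occurrence))))))

  M : Matching
  M = relabel (suc (suc i)) rest

  insertE-M : map (insertE (suc i)) M ≡ rest
  insertE-M = insertE-relabel i rest 0∉rest 1∉rest j∉rest

  N↭ : N ↭ (1 , suc (suc i)) ∷ map (insertE (suc i)) M
  N↭ = ≡.subst (λ r → N ↭ (1 , suc (suc i)) ∷ r) (≡.sym insertE-M) σ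

  M-ordered : All OrderedEdge M
  M-ordered with All-resp-↭ σ (ordered N-matching)
  ... | _ ∷ rest-ordered =
    insertE-reflects-order (suc i) M (≡.subst (All OrderedEdge) (≡.sym insertE-M) rest-ordered)

  M-multiplicity : ∀ u → occurrences u (vertices M) ≡ inRange1 (2 * m) u
  M-multiplicity u = begin
    occurrences u (vertices M)
      ≡⟨ ≡.sym (occurrences-map-insertV (suc i) u (vertices M)) ⟩
    occurrences (insertV (suc i) u) (map (insertV (suc i)) (vertices M))
      ≡⟨ cong (occurrences (insertV (suc i) u))
              (≡.trans (≡.sym (vertices-map-insertE (suc i) M)) (cong vertices insertE-M)) ⟩
    occurrences (insertV (suc i) u) (vertices rest)
      ≡⟨ in-rest u ⟩
    inRange1 (2 * m) u ∎
    where
    open ≡.≡-Reasoning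
    in-rest : ∀ u → occurrences (insertV (suc i) u) (vertices rest) ≡ inRange1 (2 * m) u
    in-rest zero = 1∉rest
    in-rest (suc u) = begin
      occurrences (suc (insertV i u)) (vertices rest)
        ≡⟨ ≡.sym (cong₂ (λ x y → fromBool x + (fromBool y + occurrences (suc (insertV i u)) (vertices rest)))
                        (insertV-≢0 i u) (insertV-≢new i u)) ⟩
      fromBool (1 ≡ᵇ suc (insertV i u)) + (fromBool (suc (suc i) ≡ᵇ suc (insertV i u))
        + occurrences (suc (insertV i u)) (vertices rest))
        ≡⟨ ≡.sym (occurrences-N (suc (insertV i u))) ⟩
      occurrences (suc (insertV i u)) (vertices N)
        ≡⟨ multiplicity N-matching (suc (insertV i u)) ⟩
      fromBool (insertV i u <ᵇ 2 * suc m)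
        ≡⟨ cong (λ K → fromBool (insertV i u <ᵇ K)) (*-suc 2 m) ⟩
      fromBool (insertV i u <ᵇ suc (suc (2 * m)))
        ≡⟨ cong fromBool (insertV-<ᵇ-above i (2 * m) u gap-bound) ⟩
      inRange1 (2 * m) (suc u) ∎

  M-matching : IsMatching′ m M
  M-matching = record { ordered = M-ordered ; multiplicity = M-multiplicity }

from : ℕ → ℕ → List ℕ
from s zero = []
from s (suc n) = s ∷ from (suc s) n

from-++ : ∀ s a b → from s (a + b) ≡ from s a ++ from (s + a) b
from-++ s zero b rewrite +-identityʳ s = refl
from-++ s (suc a) b rewrite +-suc s a = cong (s ∷_) (from-++ (suc s) a b)

take-from : ∀ k s n → k ≤ n → take k (from s n) ≡ from s k
take-from zero s n _ = refl
take-from (suc k) s (suc n) (s≤s k≤n) = cong (s ∷_) (take-from k (suc s) n k≤n)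

drop-from : ∀ k s n → drop k (from s n) ≡ from (s + k) (n ∸ k)
drop-from zero s n rewrite +-identityʳ s = refl
drop-from (suc k) s zero = refl
drop-from (suc k) s (suc n) rewrite +-suc s k = drop-from k (suc s) n

from-split : ∀ m i → i ≤ 2 * m →
             from 2 (suc i) ++ from (3 + i) (suc (2 * m) ∸ i) ≡ from 2 (2 * suc m)
from-split m i i≤2m = begin
  from 2 (suc i) ++ from (3 + i) (suc (2 * m) ∸ i)
    ≡⟨ from-++ 2 (suc i) (suc (2 * m) ∸ i) ⟨
  from 2 (suc (i + (suc (2 * m) ∸ i)))
    ≡⟨ cong (λ n → from 2 (suc n)) (m+[n∸m]≡n (m≤n⇒m≤1+n i≤2m)) ⟩
  from 2 (suc (suc (2 * m)))
    ≡⟨ cong (from 2) (*-suc 2 m) ⟨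
  from 2 (2 * suc m) ∎
  where open ≡.≡-Reasoning

module _ {a r} {A : Set a} {R : A → A → Set r} where

  take⁺ : ∀ {xs ys} k → Pointwise R xs ys → Pointwise R (take k xs) (take k ys)
  take⁺ zero _ = []
  take⁺ (suc k) [] = []
  take⁺ (suc k) (x∼y ∷ xs∼ys) = x∼y ∷ take⁺ k xs∼ys

  drop⁺ : ∀ {xs ys} k → Pointwise R xs ys → Pointwise R (drop k xs) (drop k ys)
  drop⁺ zero xs∼ys = xs∼ys
  drop⁺ (suc k) [] = []
  drop⁺ (suc k) (_ ∷ xs∼ys) = drop⁺ k xs∼ys

module GapValues {c ℓ : Level} (G : AbelianGroup c ℓ) (α β : AbelianGroup.Carrier G) where
  open AbelianGroup G renaming (refl to ≈-refl; sym to ≈-sym; trans to ≈-trans)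
  open import Relation.Binary.Reasoning.Setoid setoid
  open import Algebra.Properties.AbelianGroup G using (xyx⁻¹≈y)
  open import Algebra.Properties.CommutativeSemigroup commutativeSemigroup using (interchange)

  _≈*_ : List Carrier → List Carrier → Set _
  _≈*_ = Pointwise _≈_

  ≈*-≡ : ∀ {xs ys zs} → xs ≈* ys → ys ≡ zs → xs ≈* zs
  ≈*-≡ xs≈ys refl = xs≈ys

  times-+ : ∀ a b x → times G (a + b) x ≈ times G a x ∙ times G b x
  times-+ zero b x = ≈-sym (identityˡ _)
  times-+ (suc a) b x = ≈-trans (∙-congˡ (times-+ a b x)) (≈-sym (assoc _ _ _))

  linComb : ℕ → ℕ → Carrier
  linComb a b = times G a α ∙ times G b β

  linComb-≡ : ∀ {a b a′ b′} → a ≡ a′ → b ≡ b′ → linComb a b ≈ linComb a′ b′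
  linComb-≡ refl refl = ≈-refl

  linComb-+ : ∀ a a′ b b′ → linComb (a + a′) (b + b′) ≈ linComb a b ∙ linComb a′ b′
  linComb-+ a a′ b b′ = ≈-trans (∙-cong (times-+ a a′ α) (times-+ b b′ β)) (interchange _ _ _ _)

  α≈linComb : α ≈ linComb 1 0
  α≈linComb = ≈-sym (≈-trans (identityʳ _) (identityʳ _))

  β≈linComb : β ≈ linComb 0 1
  β≈linComb = ≈-sym (≈-trans (identityˡ _) (identityʳ _))

  gapValue : Matching → ℕ → Carrier
  gapValue X k = linComb (cr X + spanning X k) (ne X + leftOf X k)

  gapValues : Matching → ℕ → List Carrier
  gapValues X m = map (gapValue X) (from 1 (suc (2 * m)))

  gapValue-1 : ∀ X → All PositiveEdge X → gapValue X 1 ≈ linComb (cr X) (ne X)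
  gapValue-1 X pos = linComb-≡ (≡.trans (cong (cr X +_) (spanning-gap1 X pos)) (+-identityʳ _))
                               (≡.trans (cong (ne X +_) (leftOf-gap1 X pos)) (+-identityʳ _))

  gapValue-increment : ∀ X k → All PositiveEdge X →
                       gapValue X k ∙ gapValue X 1 ⁻¹ ≈ linComb (spanning X k) (leftOf X k)
  gapValue-increment X k pos = begin
    gapValue X k ∙ gapValue X 1 ⁻¹
      ≈⟨ ∙-cong (linComb-+ (cr X) (spanning X k) (ne X) (leftOf X k)) (⁻¹-cong (gapValue-1 X pos)) ⟩
    (linComb (cr X) (ne X) ∙ linComb (spanning X k) (leftOf X k)) ∙ linComb (cr X) (ne X) ⁻¹
      ≈⟨ xyx⁻¹≈y _ _ ⟩
    linComb (spanning X k) (leftOf X k) ∎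

  nth⁺ : ∀ {d d′ xs ys} k → d ≈ d′ → xs ≈* ys → nth G d k xs ≈ nth G d′ k ys
  nth⁺ k d≈d′ [] = d≈d′
  nth⁺ zero d≈d′ (_ ∷ _) = d≈d′
  nth⁺ (suc zero) d≈d′ (x≈y ∷ _) = x≈y
  nth⁺ (suc (suc k)) d≈d′ (_ ∷ xs≈ys) = nth⁺ (suc k) d≈d′ xs≈ys

  nth-map-from : ∀ (f : ℕ → Carrier) d k s n → k < n → nth G d (suc k) (map f (from s n)) ≡ f (s + k)
  nth-map-from f d zero s (suc n) _ rewrite +-identityʳ s = refl
  nth-map-from f d (suc k) s (suc n) (s≤s k<n) rewrite +-suc s k = nth-map-from f d k (suc s) n k<n

  shift-map-from : ∀ {xs y} (f g : ℕ → Carrier) d s n → xs ≈* map f (from s n) →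
                   (∀ p → s ≤ p → p < s + n → f p ∙ y ≈ g (d + p)) →
                   shift G xs y ≈* map g (from (d + s) n)
  shift-map-from f g d s zero [] _ = []
  shift-map-from f g d s (suc n) (x≈ ∷ xs≈) shifted =
    ≈-trans (∙-congʳ x≈) (shifted s ≤-refl (m<m+n s (s≤s z≤n)))
    ∷ ≈*-≡ (shift-map-from f g d (suc s) n xs≈
             (λ p s<p p<s+n → shifted p (<⇒≤ s<p) (≡.subst (p <_) (≡.sym (+-suc s n)) p<s+n)))
           (cong (λ t → map g (from t n)) (+-suc d s))

  linComb-∙ : ∀ a b c d u v →
              linComb a b ∙ (linComb c d ∙ linComb u v) ≈ linComb (a + (c + u)) (b + (d + v))
  linComb-∙ a b c d u v = ≈-sym (≈-trans (linComb-+ a (c + u) b (d + v)) (∙-congˡ (linComb-+ c u d v)))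

  module Inserted (i : ℕ) (M N : Matching) (M-positive : All PositiveEdge M) (N-positive : All PositiveEdge N)
                  (σ : N ↭ (1 , suc i) ∷ map (insertE i) M) where
    open Insertion i M N M-positive σ

    cᵢ dᵢ : ℕ
    cᵢ = spanning M i
    dᵢ = leftOf M i

    gapValue-N : ∀ p {c d} → spanning N p ≡ c → leftOf N p ≡ d →
                 gapValue N p ≈ linComb ((cᵢ + cr M) + c) ((dᵢ + ne M) + d)
    gapValue-N p c≡ d≡ = linComb-≡ (cong₂ _+_ cr-inserted c≡) (cong₂ _+_ ne-inserted d≡)

    gapValue-N-1 : gapValue M i ≈ gapValue N 1
    gapValue-N-1 = ≈-sym (≈-trans (gapValue-1 N N-positive)
      (linComb-≡ (≡.trans cr-inserted (+-comm cᵢ (cr M))) (≡.trans ne-inserted (+-comm dᵢ (ne M)))))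

    gapValue-inside : ∀ p → 1 ≤ p → p ≤ i → gapValue M p ∙ (linComb cᵢ dᵢ ∙ α) ≈ gapValue N (suc p)
    gapValue-inside p 1≤p p≤i = begin
      gapValue M p ∙ (linComb cᵢ dᵢ ∙ α)            ≈⟨ ∙-congˡ (∙-congˡ α≈linComb) ⟩
      gapValue M p ∙ (linComb cᵢ dᵢ ∙ linComb 1 0)  ≈⟨ linComb-∙ (cr M + spanning M p) (ne M + leftOf M p) cᵢ dᵢ 1 0 ⟩
      linComb ((cr M + spanning M p) + (cᵢ + 1)) ((ne M + leftOf M p) + (dᵢ + 0))
        ≈⟨ linComb-≡ (rearrange-suc (cr M) (spanning M p) cᵢ) (rearrange (ne M) (leftOf M p) dᵢ) ⟩
      linComb ((cᵢ + cr M) + suc (spanning M p)) ((dᵢ + ne M) + leftOf M p)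
        ≈⟨ gapValue-N (suc p) (spanning-inserted-inside p 1≤p p≤i) (leftOf-inserted-inside p p≤i) ⟨
      gapValue N (suc p) ∎

    gapValue-outside : ∀ p → i ≤ p → gapValue M p ∙ (linComb cᵢ dᵢ ∙ β) ≈ gapValue N (2 + p)
    gapValue-outside p i≤p = begin
      gapValue M p ∙ (linComb cᵢ dᵢ ∙ β)            ≈⟨ ∙-congˡ (∙-congˡ β≈linComb) ⟩
      gapValue M p ∙ (linComb cᵢ dᵢ ∙ linComb 0 1)  ≈⟨ linComb-∙ (cr M + spanning M p) (ne M + leftOf M p) cᵢ dᵢ 0 1 ⟩
      linComb ((cr M + spanning M p) + (cᵢ + 0)) ((ne M + leftOf M p) + (dᵢ + 1))
        ≈⟨ linComb-≡ (rearrange (cr M) (spanning M p) cᵢ) (rearrange-suc (ne M) (leftOf M p) dᵢ) ⟩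
      linComb ((cᵢ + cr M) + spanning M p) ((dᵢ + ne M) + suc (leftOf M p))
        ≈⟨ gapValue-N (suc (suc p)) (spanning-inserted-outside p i≤p) (leftOf-inserted-outside p i≤p) ⟨
      gapValue N (2 + p) ∎

  R-gapValues : ∀ {m i M N} → i ≤ 2 * m → All PositiveEdge M → All PositiveEdge N →
                N ↭ (1 , suc (suc i)) ∷ map (insertE (suc i)) M →
                ∀ xs → toList xs ≈* gapValues M m → toList (R G α β (suc i) xs) ≈* gapValues N (suc m)
  R-gapValues {m} {i} {M} {N} i≤2m M-positive N-positive σ (x ∷ xs) values@(x≈ ∷ _) =
    ≈-trans xᵢ≈ gapValue-N-1 ∷ ≈*-≡ (++⁺ inside outside) split
    where
    open Inserted (suc i) M N M-positive N-positive σ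

    xᵢ : Carrier
    xᵢ = nth G x (suc i) (x ∷ xs)

    xᵢ≈ : xᵢ ≈ gapValue M (suc i)
    xᵢ≈ = ≈-trans (nth⁺ (suc i) x≈ values)
                  (reflexive (nth-map-from (gapValue M) (gapValue M 1) i 1 _ (s≤s i≤2m)))

    increment≈ : xᵢ ∙ x ⁻¹ ≈ linComb cᵢ dᵢ
    increment≈ = ≈-trans (∙-cong xᵢ≈ (⁻¹-cong x≈)) (gapValue-increment M (suc i) M-positive)

    inside : shift G (take (suc i) (x ∷ xs)) ((xᵢ ∙ x ⁻¹) ∙ α) ≈* map (gapValue N) (from 2 (suc i))
    inside = shift-map-from (gapValue M) (gapValue N) 1 1 (suc i)
      (≈*-≡ (take⁺ (suc i) values)
            (≡.trans (take-map (suc i) (from 1 (suc (2 * m))))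
                     (cong (map (gapValue M)) (take-from (suc i) 1 (suc (2 * m)) (s≤s i≤2m)))))
      (λ p 1≤p p<2+i → ≈-trans (∙-congˡ (∙-congʳ increment≈)) (gapValue-inside p 1≤p (≤-pred p<2+i)))

    outside : shift G (drop i (x ∷ xs)) ((xᵢ ∙ x ⁻¹) ∙ β)
              ≈* map (gapValue N) (from (3 + i) (suc (2 * m) ∸ i))
    outside = shift-map-from (gapValue M) (gapValue N) 2 (suc i) (suc (2 * m) ∸ i)
      (≈*-≡ (drop⁺ i values)
            (≡.trans (drop-map i (from 1 (suc (2 * m))))
                     (cong (map (gapValue M)) (drop-from i 1 (suc (2 * m))))))
      (λ p 1+i≤p _ → ≈-trans (∙-congˡ (∙-congʳ increment≈)) (gapValue-outside p 1+i≤p))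

    split : map (gapValue N) (from 2 (suc i)) ++ map (gapValue N) (from (3 + i) (suc (2 * m) ∸ i))
          ≡ map (gapValue N) (from 2 (2 * suc m))
    split = ≡.trans (≡.sym (map-++ (gapValue N) (from 2 (suc i)) _))
                    (cong (map (gapValue N)) (from-split m i i≤2m))

  seqF-gapValues : ∀ m N → IsMatching′ m N → toList (seqF G α β m N) ≈* gapValues N m
  seqF-gapValues zero [] _ = ≈-sym (identityˡ ε) ∷ []
  seqF-gapValues zero (e ∷ es) N-matching = ⊥-elim (IsMatching′-0-empty N-matching)
  seqF-gapValues (suc m) N N-matching with extract N in eq
  ... | nothing = ⊥-elim (IsMatching′-extract≢nothing N-matching eq)
  ... | just (zero , rest) with () ← extract-first-edge-ordered N-matching eq
  ... | just (suc zero , rest) with s≤s () ← extract-first-edge-ordered N-matching eq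
  ... | just (suc (suc i) , rest) =
    R-gapValues gap-bound (IsMatching′-positive M-matching) (IsMatching′-positive N-matching) N↭
                (seqF G α β m M) (seqF-gapValues m M M-matching)
    where open Removal m i rest N N-matching (extract-↭ N eq)

  head-seq : ∀ n N → IsMatching′ n N → length N ≡ n → head (seq G α β N) ≈ linComb (cr N) (ne N)
  head-seq n N N-matching refl with seqF G α β (length N) N | seqF-gapValues (length N) N N-matching
  ... | _ ∷ _ | x≈ ∷ _ = ≈-trans x≈ (gapValue-1 N (IsMatching′-positive N-matching))

lemma2p3 : ∀ {c ℓ} (G : AbelianGroup c ℓ) (α β : AbelianGroup.Carrier G)
             (n : ℕ) (N : Matching) → IsMatching n N →
             AbelianGroup._≈_ G (head (seq G α β N))
               (AbelianGroup._∙_ G (times G (cr N) α) (times G (ne N) β))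
lemma2p3 G α β n N N-matching =
  GapValues.head-seq G α β n N (IsMatching⇒IsMatching′ N-matching) (IsMatching-length N-matching)
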